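{- In the ordered adjoint sequent calculus in which the identity rule is restricted to atomic propositions (i.e. only $x{:}P_m\vdash P_m$ for atomic $P_m$ is an axiom), the sequent $x{:}A_m\vdash A_m$ is derivable for every proposition $A_m$; that is, the unrestricted identity rule is admissible.
   Context: Ordered adjoint sequent calculus. Fix a preorder $(\mathcal{M},\geq)$ of modes and, for each mode $m$, a set $\sigma(m)\subseteq\{\mathsf{W},\mathsf{C}^\leftarrow,\mathsf{C}^\rightarrow,\mathsf{M}^\leftarrow,\mathsf{M}^\rightarrow\}$, monotone: $k\geq m$ implies $\sigma(k)\supseteq\sigma(m)$. Propositions: $A_m ::= P_m \mid A_m \rightarrowtail B_m \mid A_m \twoheadrightarrow B_m \mid A_m \,\&\, B_m \mid {\uparrow}^m_l A_l\ (m\geq l) \mid A_m\bullet B_m \mid 1_m \mid A_m\oplus B_m \mid {\downarrow}^k_m A_k\ (k\geq m)$, with $P_m$ atomic. An ordered context $\Omega$ is a finite sequence of labeled antecedents $x{:}A_m$; a variable may occur several times, all occurrences labeling the same proposition. $\Omega\geq m$ means every antecedent $y{:}B_k$ of $\Omega$ has $k\geq m$. A sequent $\Omega\vdash C_r$ presupposes $\Omega\geq r$. Newly introduced variables in premises are fresh. Rules (premises $\Rightarrow$ conclusion): (id) $\Rightarrow x{:}A_m\vdash A_m$. (cut) $\Omega_A\vdash A_m$ and $\Omega_L(x{:}A_m)\Omega_R\vdash C_r$ with $\Omega_A\geq m\geq r$ $\Rightarrow \Omega_L\Omega_A\Omega_R\vdash C_r$. ($1R$) $\Rightarrow \cdot\vdash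 1_m$. ($1L$) $\Omega_L\Omega_R\vdash C_r \Rightarrow \Omega_L(x{:}1_m)\Omega_R\vdash C_r$. ($\bullet R$) $\Omega_1\vdash A_m$, $\Omega_2\vdash B_m\Rightarrow \Omega_1\Omega_2\vdash A_m\bullet B_m$. ($\bullet L$) $\Omega_L(x_1{:}A_m)(x_2{:}B_m)\Omega_R\vdash C_r\Rightarrow\Omega_L(x{:}A_m\bullet B_m)\Omega_R\vdash C_r$. ($\oplus R_i$) $\Omega\vdash A_m$ (resp. $\Omega\vdash B_m$) $\Rightarrow\Omega\vdash A_m\oplus B_m$. ($\oplus L$) $\Omega_L(y{:}A_m)\Omega_R\vdash C_r$ and $\Omega_L(y{:}B_m)\Omega_R\vdash C_r\Rightarrow\Omega_L(x{:}A_m\oplus B_m)\Omega_R\vdash C_r$. (${\downarrow}R$) $\Omega\vdash A_k$ with $\Omega\geq k\Rightarrow\Omega\vdash{\downarrow}^k_mA_k$. (${\downarrow}L$) $\Omega_L(y{:}A_k)\Omega_R\vdash C_r\Rightarrow\Omega_L(x{:}{\downarrow}^k_mA_k)\Omega_R\vdash C_r$. ($\twoheadrightarrow R$) $\Omega(x{:}A_m)\vdash B_m\Rightarrow\Omega\vdash A_m\twoheadrightarrow B_m$. ($\twoheadrightarrow L$) $\Omega_A\vdash A_m$, $\Omega_A\geq m$, $\Omega_L(y{:}B_m)\Omega_R\vdash C_r\Rightarrow\Omega_L(f{:}A_m\twoheadrightarrow B_m)\Omega_A\Omega_R\vdash C_r$. ($\rightarrowtail R$) $(x{:}A_m)\Omega\vdash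 B_m\Rightarrow\Omega\vdash A_m\rightarrowtail B_m$. ($\rightarrowtail L$) $\Omega_A\vdash A_m$, $\Omega_A\geq m$, $\Omega_L(y{:}B_m)\Omega_R\vdash C_r\Rightarrow\Omega_L\Omega_A(f{:}A_m\rightarrowtail B_m)\Omega_R\vdash C_r$. ($\& R$) $\Omega\vdash A_m$, $\Omega\vdash B_m\Rightarrow\Omega\vdash A_m\&B_m$. ($\& L_i$) $\Omega_L(y{:}A_m)\Omega_R\vdash C_r$ (resp. $y{:}B_m$) $\Rightarrow\Omega_L(x{:}A_m\&B_m)\Omega_R\vdash C_r$. (${\uparrow}R$) $\Omega\vdash A_l\Rightarrow\Omega\vdash{\uparrow}^m_lA_l$. (${\uparrow}L$) $\Omega_L(y{:}A_l)\Omega_R\vdash C_r$ with $l\geq r\Rightarrow\Omega_L(x{:}{\uparrow}^m_lA_l)\Omega_R\vdash C_r$. Structural rules: ($\mathsf{M}^\leftarrow$) $\Omega_L\Omega_M(x{:}A_m)\Omega_R\vdash C_r$, $\mathsf{M}^\leftarrow\in\sigma(m)\Rightarrow\Omega_L(x{:}A_m)\Omega_M\Omega_R\vdash C_r$. ($\mathsf{M}^\rightarrow$) $\Omega_L(x{:}A_m)\Omega_M\Omega_R\vdash C_r$, $\mathsf{M}^\rightarrow\in\sigma(m)\Rightarrow\Omega_L\Omega_M(x{:}A_m)\Omega_R\vdash C_r$. ($\mathsf{C}^\leftarrow$) $\Omega_L(x{:}A_m)\Omega_M(x{:}A_m)\Omega_R\vdash C_r$, $\mathsf{C}^\leftarrow\in\sigma(m)\Rightarrow\Omega_L(x{:}A_m)\Omega_M\Omega_R\vdash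 C_r$. ($\mathsf{C}^\rightarrow$) same premise, $\mathsf{C}^\rightarrow\in\sigma(m)\Rightarrow\Omega_L\Omega_M(x{:}A_m)\Omega_R\vdash C_r$. ($\mathsf{W}$) $\Omega_L\Omega_R\vdash C_r$, $\mathsf{W}\in\sigma(m)\Rightarrow\Omega_L(x{:}A_m)\Omega_R\vdash C_r$. -}

module Defs where

open import Data.Nat using (ℕ)
open import Data.List using (List; []; _∷_; _++_; map)
open import Data.List.Relation.Unary.All using (All)
open import Data.List.Membership.Propositional using (_∉_)
open import Relation.Binary.PropositionalEquality using (_≢_)

data Struct : Set where
  W C← C→ M← M→ : Struct

record ModeSig : Set₁ where
  field
    Mode      : Set
    _≥_       : Mode → Mode → Set
    ≥-refl    : ∀ {m} → m ≥ m
    ≥-trans   : ∀ {k l m} → k ≥ l → l ≥ m → k ≥ m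
    σ         : Mode → Struct → Set
    σ-mono    : ∀ {k m s} → k ≥ m → σ m s → σ k s
    Atom      : Mode → Set

Var : Set
Var = ℕ

module Calculus (S : ModeSig) where
  open ModeSig S

  infixr 5 _↣_ _↠_
  infixr 6 _&_ _⊕_
  infixr 7 _•_

  data Pr : Mode → Set where
    atom : ∀ {m} → Atom m → Pr m
    _↣_  : ∀ {m} → Pr m → Pr m → Pr m
    _↠_  : ∀ {m} → Pr m → Pr m → Pr m
    _&_  : ∀ {m} → Pr m → Pr m → Pr m
    ↑    : ∀ {m l} → m ≥ l → Pr l → Pr m
    _•_  : ∀ {m} → Pr m → Pr m → Pr m
    𝟙    : ∀ {m} → Pr m
    _⊕_  : ∀ {m} → Pr m → Pr m → Pr m
    ↓    : ∀ {k m} → k ≥ m → Pr k → Pr m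

  record Hyp : Set where
    constructor _∶_
    field
      {mode} : Mode
      var    : Var
      prop   : Pr mode

  Ctx : Set
  Ctx = List Hyp

  vars : Ctx → List Var
  vars = map Hyp.var

  _≥ᶜ_ : Ctx → Mode → Set
  Ω ≥ᶜ m = All (λ h → Hyp.mode h ≥ m) Ω

  infix 4 _⊢_

  data _⊢_ : Ctx → ∀ {r} → Pr r → Set where
    id-atom : ∀ {m} (x : Var) (P : Atom m) → (x ∶ atom P) ∷ [] ⊢ atom P
    cut : ∀ {m r} {A : Pr m} {C : Pr r} (ΩA ΩL ΩR : Ctx) (x : Var) →
          x ∉ vars (ΩL ++ ΩA ++ ΩR) → ΩA ≥ᶜ m → m ≥ r →
          ΩA ⊢ A → ΩL ++ (x ∶ A) ∷ ΩR ⊢ C →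
          ΩL ++ ΩA ++ ΩR ⊢ C
    𝟙R : ∀ {m} → [] ⊢ 𝟙 {m}
    𝟙L : ∀ {m r} {C : Pr r} (ΩL ΩR : Ctx) (x : Var) →
         ΩL ++ ΩR ⊢ C → ΩL ++ (x ∶ 𝟙 {m}) ∷ ΩR ⊢ C
    •R : ∀ {m} {A B : Pr m} (Ω₁ Ω₂ : Ctx) →
         Ω₁ ⊢ A → Ω₂ ⊢ B → Ω₁ ++ Ω₂ ⊢ A • B
    •L : ∀ {m r} {A B : Pr m} {C : Pr r} (ΩL ΩR : Ctx) (x x₁ x₂ : Var) →
         x₁ ∉ vars (ΩL ++ (x ∶ (A • B)) ∷ ΩR) →
         x₂ ∉ vars (ΩL ++ (x ∶ (A • B)) ∷ ΩR) → x₁ ≢ x₂ →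
         ΩL ++ (x₁ ∶ A) ∷ (x₂ ∶ B) ∷ ΩR ⊢ C →
         ΩL ++ (x ∶ (A • B)) ∷ ΩR ⊢ C
    ⊕R₁ : ∀ {m} {A B : Pr m} (Ω : Ctx) → Ω ⊢ A → Ω ⊢ A ⊕ B
    ⊕R₂ : ∀ {m} {A B : Pr m} (Ω : Ctx) → Ω ⊢ B → Ω ⊢ A ⊕ B
    ⊕L : ∀ {m r} {A B : Pr m} {C : Pr r} (ΩL ΩR : Ctx) (x y : Var) →
         y ∉ vars (ΩL ++ (x ∶ (A ⊕ B)) ∷ ΩR) →
         ΩL ++ (y ∶ A) ∷ ΩR ⊢ C → ΩL ++ (y ∶ B) ∷ ΩR ⊢ C →
         ΩL ++ (x ∶ (A ⊕ B)) ∷ ΩR ⊢ C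
    ↓R : ∀ {k m} (k≥m : k ≥ m) {A : Pr k} (Ω : Ctx) →
         Ω ≥ᶜ k → Ω ⊢ A → Ω ⊢ ↓ k≥m A
    ↓L : ∀ {k m r} (k≥m : k ≥ m) {A : Pr k} {C : Pr r} (ΩL ΩR : Ctx) (x y : Var) →
         y ∉ vars (ΩL ++ (x ∶ ↓ k≥m A) ∷ ΩR) →
         ΩL ++ (y ∶ A) ∷ ΩR ⊢ C → ΩL ++ (x ∶ ↓ k≥m A) ∷ ΩR ⊢ C
    ↠R : ∀ {m} {A B : Pr m} (Ω : Ctx) (x : Var) → x ∉ vars Ω →
         Ω ++ (x ∶ A) ∷ [] ⊢ B → Ω ⊢ A ↠ B
    ↠L : ∀ {m r} {A B : Pr m} {C : Pr r} (ΩA ΩL ΩR : Ctx) (f y : Var) →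
         y ∉ vars (ΩL ++ (f ∶ (A ↠ B)) ∷ ΩA ++ ΩR) →
         ΩA ⊢ A → ΩA ≥ᶜ m → ΩL ++ (y ∶ B) ∷ ΩR ⊢ C →
         ΩL ++ (f ∶ (A ↠ B)) ∷ ΩA ++ ΩR ⊢ C
    ↣R : ∀ {m} {A B : Pr m} (Ω : Ctx) (x : Var) → x ∉ vars Ω →
         (x ∶ A) ∷ Ω ⊢ B → Ω ⊢ A ↣ B
    ↣L : ∀ {m r} {A B : Pr m} {C : Pr r} (ΩA ΩL ΩR : Ctx) (f y : Var) →
         y ∉ vars (ΩL ++ ΩA ++ (f ∶ (A ↣ B)) ∷ ΩR) →
         ΩA ⊢ A → ΩA ≥ᶜ m → ΩL ++ (y ∶ B) ∷ ΩR ⊢ C →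
         ΩL ++ ΩA ++ (f ∶ (A ↣ B)) ∷ ΩR ⊢ C
    &R : ∀ {m} {A B : Pr m} (Ω : Ctx) → Ω ⊢ A → Ω ⊢ B → Ω ⊢ A & B
    &L₁ : ∀ {m r} {A B : Pr m} {C : Pr r} (ΩL ΩR : Ctx) (x y : Var) →
          y ∉ vars (ΩL ++ (x ∶ (A & B)) ∷ ΩR) →
          ΩL ++ (y ∶ A) ∷ ΩR ⊢ C → ΩL ++ (x ∶ (A & B)) ∷ ΩR ⊢ C
    &L₂ : ∀ {m r} {A B : Pr m} {C : Pr r} (ΩL ΩR : Ctx) (x y : Var) →
          y ∉ vars (ΩL ++ (x ∶ (A & B)) ∷ ΩR) →
          ΩL ++ (y ∶ B) ∷ ΩR ⊢ C → ΩL ++ (x ∶ (A & B)) ∷ ΩR ⊢ C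
    ↑R : ∀ {m l} (m≥l : m ≥ l) {A : Pr l} (Ω : Ctx) → Ω ⊢ A → Ω ⊢ ↑ m≥l A
    ↑L : ∀ {m l r} (m≥l : m ≥ l) {A : Pr l} {C : Pr r} (ΩL ΩR : Ctx) (x y : Var) →
         y ∉ vars (ΩL ++ (x ∶ ↑ m≥l A) ∷ ΩR) → l ≥ r →
         ΩL ++ (y ∶ A) ∷ ΩR ⊢ C → ΩL ++ (x ∶ ↑ m≥l A) ∷ ΩR ⊢ C
    M←R : ∀ {m r} {A : Pr m} {C : Pr r} (ΩL ΩM ΩR : Ctx) (x : Var) → σ m M← →
          ΩL ++ ΩM ++ (x ∶ A) ∷ ΩR ⊢ C → ΩL ++ (x ∶ A) ∷ ΩM ++ ΩR ⊢ C
    M→R : ∀ {m r} {A : Pr m} {C : Pr r} (ΩL ΩM ΩR : Ctx) (x : Var) → σ m M→ →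
          ΩL ++ (x ∶ A) ∷ ΩM ++ ΩR ⊢ C → ΩL ++ ΩM ++ (x ∶ A) ∷ ΩR ⊢ C
    C←R : ∀ {m r} {A : Pr m} {C : Pr r} (ΩL ΩM ΩR : Ctx) (x : Var) → σ m C← →
          ΩL ++ (x ∶ A) ∷ ΩM ++ (x ∶ A) ∷ ΩR ⊢ C → ΩL ++ (x ∶ A) ∷ ΩM ++ ΩR ⊢ C
    C→R : ∀ {m r} {A : Pr m} {C : Pr r} (ΩL ΩM ΩR : Ctx) (x : Var) → σ m C→ →
          ΩL ++ (x ∶ A) ∷ ΩM ++ (x ∶ A) ∷ ΩR ⊢ C → ΩL ++ ΩM ++ (x ∶ A) ∷ ΩR ⊢ C
    WR : ∀ {m r} {A : Pr m} {C : Pr r} (ΩL ΩR : Ctx) (x : Var) → σ m W →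
         ΩL ++ ΩR ⊢ C → ΩL ++ (x ∶ A) ∷ ΩR ⊢ C

module Submission where

-- Identity expansion, by induction on A: the antecedent x : A is taken apart
-- by the left rule of its main connective and the succedent rebuilt by the
-- right rule, the components receiving the fresh labels suc x and
-- suc (suc x).  Every mode side condition compares the mode of A with itself
-- (or, for ↑ and ↓, with the mode the shift already records), so reflexivity
-- of ≥ discharges it.

open import Defs
open import Data.List using ([]; _∷_)
open import Data.List.Relation.Unary.All using ([]; _∷_)
open import Data.List.Relation.Unary.All.Properties using (All¬⇒¬Any)
open import Data.List.Membership.Propositional using (_∉_)
open import Data.Nat using (ℕ; suc)
open import Data.Nat.Properties using (1+n≢n; m+1+n≢n)
open import Relation.Binary.PropositionalEquality using (≢-sym)

suc-fresh : ∀ {x : ℕ} → suc x ∉ x ∷ []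
suc-fresh = All¬⇒¬Any (1+n≢n ∷ [])

module _ (S : ModeSig) where
  open ModeSig S
  open Calculus S

  identity : ∀ {m} (x : Var) (A : Pr m) → (x ∶ A) ∷ [] ⊢ A
  identity x (atom P) = id-atom x P
  identity x (A ↣ B) =
    ↣R _ (suc x) suc-fresh
      (↣L ((suc x ∶ A) ∷ []) [] [] x (suc (suc x))
        (All¬⇒¬Any (1+n≢n ∷ m+1+n≢n 1 ∷ []))
        (identity (suc x) A) (≥-refl ∷ []) (identity (suc (suc x)) B))
  identity x (A ↠ B) =
    ↠R _ (suc x) suc-fresh
      (↠L ((suc x ∶ A) ∷ []) [] [] x (suc (suc x))
        (All¬⇒¬Any (m+1+n≢n 1 ∷ 1+n≢n ∷ []))
        (identity (suc x) A) (≥-refl ∷ []) (identity (suc (suc x)) B))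
  identity x (A & B) =
    &R _ (&L₁ [] [] x (suc x) suc-fresh (identity (suc x) A))
         (&L₂ [] [] x (suc x) suc-fresh (identity (suc x) B))
  identity x (↑ m≥l A) =
    ↑R m≥l _ (↑L m≥l [] [] x (suc x) suc-fresh ≥-refl (identity (suc x) A))
  identity x (A • B) =
    •L [] [] x (suc x) (suc (suc x))
      suc-fresh (All¬⇒¬Any (m+1+n≢n 1 ∷ [])) (≢-sym 1+n≢n)
      (•R ((suc x ∶ A) ∷ []) _ (identity (suc x) A) (identity (suc (suc x)) B))
  identity x 𝟙 = 𝟙L [] [] x 𝟙R
  identity x (A ⊕ B) =
    ⊕L [] [] x (suc x) suc-fresh
      (⊕R₁ _ (identity (suc x) A)) (⊕R₂ _ (identity (suc x) B))
  identity x (↓ k≥m A) =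
    ↓L k≥m [] [] x (suc x) suc-fresh
      (↓R k≥m _ (≥-refl ∷ []) (identity (suc x) A))

theorem3 : (S : ModeSig) → let open Calculus S in
    ∀ {m : ModeSig.Mode S} (x : Var) (A : Pr m) → (x ∶ A) ∷ [] ⊢ A
theorem3 = identity
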